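{- Let $N\ge2$, $n\ge3$ and $a,b\in\mathbb{Z}/N\mathbb{Z}$. The $n$-tuple $(a,2,2,\dots,2,b)\in(\mathbb{Z}/N\mathbb{Z})^n$ (first entry $a$, last entry $b$, all other entries $2$) is a solution of $(E_N)$ if and only if either $a=b=2$ and $n\equiv0 \pmod N$, or $a=b=0$ and $n\equiv 2\pmod N$.
   Context: For $a_1,\dots,a_n\in\mathbb{Z}/N\mathbb{Z}$ set $M_n(a_1,\dots,a_n)=\begin{pmatrix}a_n&-1\\1&0\end{pmatrix}\cdots\begin{pmatrix}a_1&-1\\1&0\end{pmatrix}$. An $n$-tuple is a solution of $(E_N)$ if $M_n(a_1,\dots,a_n)=\pm\mathrm{Id}$ over $\mathbb{Z}/N\mathbb{Z}$. -}

module Defs where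

open import Data.Nat using (ℕ)
open import Data.Integer using (ℤ; +_; _+_; _*_; _-_; -_)
open import Data.Integer.Divisibility using (_∣_)
open import Data.List using (List; []; _∷_)
open import Data.Product using (_×_)
open import Data.Sum using (_⊎_)

-- Congruence modulo N on ℤ: elements of ℤ/Nℤ are represented by integers,
-- and equality in ℤ/Nℤ is  x ≡ y [mod N]  i.e.  N ∣ (x - y).
infix 4 _≡_[mod_] _≡ₘ_[mod_]
_≡_[mod_] : ℤ → ℤ → ℕ → Set
x ≡ y [mod N ] = (+ N) ∣ (x - y)

record Mat2 : Set where
  constructor mat
  field
    m11 m12 m21 m22 : ℤ
open Mat2 public

_·_ : Mat2 → Mat2 → Mat2
mat a b c d · mat e f g h =
  mat (a * e + b * g) (a * f + b * h) (c * e + d * g) (c * f + d * h)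

Id : Mat2
Id = mat (+ 1) (+ 0) (+ 0) (+ 1)

-Id : Mat2
-Id = mat (- + 1) (+ 0) (+ 0) (- + 1)

A : ℤ → Mat2
A a = mat a (- + 1) (+ 1) (+ 0)

M : List ℤ → Mat2
M []       = Id
M (a ∷ as) = M as · A a

_≡ₘ_[mod_] : Mat2 → Mat2 → ℕ → Set
P ≡ₘ Q [mod N ] =
  (m11 P ≡ m11 Q [mod N ]) × (m12 P ≡ m12 Q [mod N ]) ×
  (m21 P ≡ m21 Q [mod N ]) × (m22 P ≡ m22 Q [mod N ])

IsSolution : ℕ → List ℤ → Set
IsSolution N as = (M as ≡ₘ Id [mod N ]) ⊎ (M as ≡ₘ -Id [mod N ])

{-# OPTIONS --safe #-}
-- Since A(2) − I is nilpotent, k factors A(2) multiply to [[k+1, −k], [k, 1−k]], so the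
-- matrix of (a, 2, …, 2, b) has entries polynomial in a, b and the length n; in particular
-- m₂₂ = 1 − n, m₂₁ = (n−1)a − (n−2) and m₁₂ = (n−2) − (n−1)b. Hence m₂₂ ≡ ±1 pins down
-- n mod N, after which m₂₁ ≡ m₁₂ ≡ 0 pin down a and b; conversely those values give ±Id.
module Submission where

open import Defs
open import Data.Nat using (ℕ; zero; suc; _≥_; _∸_)
open import Data.Nat.Properties using (m∸n+n≡m; <⇒≤)
open import Data.Integer using (ℤ; +_; _+_; _*_; _-_; -_)
open import Data.Integer.Divisibility.Signed using (_∣_; ∣ᵤ⇒∣; ∣⇒∣ᵤ; ∣m∣n⇒∣m+n; ∣n⇒∣m*n)
open import Data.Integer.Tactic.RingSolver using (solve; solve-∀)
open import Data.List using (List; _∷_; []; replicate; _++_)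
open import Data.Product using (_×_; _,_)
open import Data.Sum using (_⊎_)
open import Data.Sum.Function.Propositional using (_⊎-⇔_)
open import Function.Base using (_∘_)
open import Function.Bundles using (_⇔_; mk⇔; Equivalence)
open import Relation.Binary.PropositionalEquality using (_≡_; refl; sym; cong; subst)

open Equivalence using (to; from)

∣-multiple : ∀ {d x t} (p : ℤ) → d ∣ x → t ≡ p * x → d ∣ t
∣-multiple p d∣x t≡ = subst (_ ∣_) (sym t≡) (∣n⇒∣m*n p d∣x)

∣-combine : ∀ {d x y t} (p q : ℤ) → d ∣ x → d ∣ y → t ≡ p * x + q * y → d ∣ t
∣-combine p q d∣x d∣y t≡ = subst (_ ∣_) (sym t≡) (∣m∣n⇒∣m+n (∣n⇒∣m*n p d∣x) (∣n⇒∣m*n q d∣y))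

-- Work with signed divisibility from here on: being a record, it lets Agda read
-- the divided term off a proof, which the unsigned one used by _≡_[mod_] does not.
≡ₘ⇔∣ : ∀ {N} P Q → P ≡ₘ Q [mod N ] ⇔
  ((+ N ∣ m11 P - m11 Q) × (+ N ∣ m12 P - m12 Q) × (+ N ∣ m21 P - m21 Q) × (+ N ∣ m22 P - m22 Q))
≡ₘ⇔∣ P Q = mk⇔
  (λ (e₁₁ , e₁₂ , e₂₁ , e₂₂) → ∣ᵤ⇒∣ e₁₁ , ∣ᵤ⇒∣ e₁₂ , ∣ᵤ⇒∣ e₂₁ , ∣ᵤ⇒∣ e₂₂)
  (λ (e₁₁ , e₁₂ , e₂₁ , e₂₂) → ∣⇒∣ᵤ e₁₁ , ∣⇒∣ᵤ e₁₂ , ∣⇒∣ᵤ e₂₁ , ∣⇒∣ᵤ e₂₂)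

mat-cong : ∀ {a b c d a′ b′ c′ d′} → a ≡ a′ → b ≡ b′ → c ≡ c′ → d ≡ d′ →
           mat a b c d ≡ mat a′ b′ c′ d′
mat-cong refl refl refl refl = refl

M-twos-last : ∀ b k → let K = + k in
  M (replicate k (+ 2) ++ b ∷ []) ≡ mat (b * (K + + 1) - K) (K - b * K - + 1) (K + + 1) (- K)
M-twos-last b zero    = mat-cong (m₁₁ b) (m₁₂ b) refl refl
  where
  m₁₁ : ∀ b → + 1 * b + + 0 * + 1 ≡ b * (+ 0 + + 1) - + 0
  m₁₁ = solve-∀
  m₁₂ : ∀ b → + 1 * - + 1 + + 0 * + 0 ≡ + 0 - b * + 0 - + 1
  m₁₂ = solve-∀
M-twos-last b (suc k) rewrite M-twos-last b k =
  mat-cong (m₁₁ b (+ k)) (m₁₂ b (+ k)) (m₂₁ (+ k)) (m₂₂ (+ k))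
  where
  -- + suc k is written + 1 + K, to which it is definitionally equal.
  m₁₁ : ∀ b K → (b * (K + + 1) - K) * + 2 + (K - b * K - + 1) * + 1 ≡ b * ((+ 1 + K) + + 1) - (+ 1 + K)
  m₁₁ = solve-∀
  m₁₂ : ∀ b K → (b * (K + + 1) - K) * - + 1 + (K - b * K - + 1) * + 0 ≡ (+ 1 + K) - b * (+ 1 + K) - + 1
  m₁₂ = solve-∀
  m₂₁ : ∀ K → (K + + 1) * + 2 + - K * + 1 ≡ (+ 1 + K) + + 1
  m₂₁ = solve-∀
  m₂₂ : ∀ K → (K + + 1) * - + 1 + - K * + 0 ≡ - (+ 1 + K)
  m₂₂ = solve-∀

framedMatrix : ℤ → ℤ → ℤ → Mat2
framedMatrix a b n =
  mat ((n - + 1) * a * b - (n - + 2) * (a + b) + n - + 3) ((n - + 2) - (n - + 1) * b)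
      ((n - + 1) * a - (n - + 2))                          (+ 1 - n)

M-framed : ∀ a b k → M (a ∷ replicate k (+ 2) ++ b ∷ []) ≡ framedMatrix a b (+ k + + 2)
M-framed a b k rewrite M-twos-last b k =
  mat-cong (m₁₁ a b (+ k)) (m₁₂ b (+ k)) (m₂₁ a (+ k)) (m₂₂ (+ k))
  where
  m₁₁ : ∀ a b K → (b * (K + + 1) - K) * a + (K - b * K - + 1) * + 1
                ≡ (K + + 2 - + 1) * a * b - (K + + 2 - + 2) * (a + b) + (K + + 2) - + 3
  m₁₁ = solve-∀
  m₁₂ : ∀ b K → (b * (K + + 1) - K) * - + 1 + (K - b * K - + 1) * + 0 ≡ (K + + 2 - + 2) - (K + + 2 - + 1) * b
  m₁₂ = solve-∀
  m₂₁ : ∀ a K → (K + + 1) * a + - K * + 1 ≡ (K + + 2 - + 1) * a - (K + + 2 - + 2)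
  m₂₁ = solve-∀
  m₂₂ : ∀ K → (K + + 1) * - + 1 + - K * + 0 ≡ + 1 - (K + + 2)
  m₂₂ = solve-∀

module _ {N : ℕ} (a b n : ℤ) where

  -- The entries are spelled out (not projections of framedMatrix) so that the ring
  -- solver sees them as polynomials in a, b, n.
  FramedCongruent : ℤ → Set
  FramedCongruent s =
    (+ N ∣ ((n - + 1) * a * b - (n - + 2) * (a + b) + n - + 3) - s) ×
    (+ N ∣ ((n - + 2) - (n - + 1) * b) - + 0) ×
    (+ N ∣ ((n - + 1) * a - (n - + 2)) - + 0) ×
    (+ N ∣ (+ 1 - n) - s)

  framed≡scalar⇔ : ∀ s → framedMatrix a b n ≡ₘ mat s (+ 0) (+ 0) s [mod N ] ⇔ FramedCongruent s
  framed≡scalar⇔ s = ≡ₘ⇔∣ (framedMatrix a b n) (mat s (+ 0) (+ 0) s)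

  IdCondition NegIdCondition : Set
  IdCondition    = (a ≡ + 2 [mod N ]) × (b ≡ + 2 [mod N ]) × (n ≡ + 0 [mod N ])
  NegIdCondition = (a ≡ + 0 [mod N ]) × (b ≡ + 0 [mod N ]) × (n ≡ + 2 [mod N ])

  congruent⇒IdCondition : FramedCongruent (+ 1) → IdCondition
  congruent⇒IdCondition (_ , m₁₂≡0 , m₂₁≡0 , m₂₂≡1) = ∣⇒∣ᵤ N∣a-2 , ∣⇒∣ᵤ N∣b-2 , ∣⇒∣ᵤ N∣n
    where
    N∣n : + N ∣ n - + 0
    N∣n = ∣-multiple (- + 1) m₂₂≡1 (solve (n ∷ []))
    N∣a-2 : + N ∣ a - + 2
    N∣a-2 = ∣-combine (- + 1) (a - + 1) m₂₁≡0 N∣n (solve (a ∷ n ∷ []))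
    N∣b-2 : + N ∣ b - + 2
    N∣b-2 = ∣-combine (+ 1) (b - + 1) m₁₂≡0 N∣n (solve (b ∷ n ∷ []))

  IdCondition⇒congruent : IdCondition → FramedCongruent (+ 1)
  IdCondition⇒congruent (a≡2 , b≡2 , n≡0) =
    ∣-combine ((a - + 1) * (b - + 1)) (- (b - + 2)) N∣n N∣a-2 (solve (a ∷ b ∷ n ∷ [])) ,
    ∣-combine (- (b - + 1)) (+ 1) N∣n N∣b-2 (solve (b ∷ n ∷ [])) ,
    ∣-combine (a - + 1) (- + 1) N∣n N∣a-2 (solve (a ∷ n ∷ [])) ,
    ∣-multiple (- + 1) N∣n (solve (n ∷ []))
    where
    N∣a-2 : + N ∣ a - + 2
    N∣a-2 = ∣ᵤ⇒∣ a≡2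
    N∣b-2 : + N ∣ b - + 2
    N∣b-2 = ∣ᵤ⇒∣ b≡2
    N∣n : + N ∣ n - + 0
    N∣n = ∣ᵤ⇒∣ n≡0

  congruent⇒NegIdCondition : FramedCongruent (- + 1) → NegIdCondition
  congruent⇒NegIdCondition (_ , m₁₂≡0 , m₂₁≡0 , m₂₂≡-1) = ∣⇒∣ᵤ N∣a , ∣⇒∣ᵤ N∣b , ∣⇒∣ᵤ N∣n-2
    where
    N∣n-2 : + N ∣ n - + 2
    N∣n-2 = ∣-multiple (- + 1) m₂₂≡-1 (solve (n ∷ []))
    N∣a : + N ∣ a - + 0
    N∣a = ∣-combine (+ 1) (+ 1 - a) m₂₁≡0 N∣n-2 (solve (a ∷ n ∷ []))
    N∣b : + N ∣ b - + 0
    N∣b = ∣-combine (- + 1) (+ 1 - b) m₁₂≡0 N∣n-2 (solve (b ∷ n ∷ []))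

  NegIdCondition⇒congruent : NegIdCondition → FramedCongruent (- + 1)
  NegIdCondition⇒congruent (a≡0 , b≡0 , n≡2) =
    ∣-combine ((a - + 1) * (b - + 1)) b N∣n-2 N∣a (solve (a ∷ b ∷ n ∷ [])) ,
    ∣-combine (- (b - + 1)) (- + 1) N∣n-2 N∣b (solve (b ∷ n ∷ [])) ,
    ∣-combine (a - + 1) (+ 1) N∣n-2 N∣a (solve (a ∷ n ∷ [])) ,
    ∣-multiple (- + 1) N∣n-2 (solve (n ∷ []))
    where
    N∣a : + N ∣ a - + 0
    N∣a = ∣ᵤ⇒∣ a≡0
    N∣b : + N ∣ b - + 0
    N∣b = ∣ᵤ⇒∣ b≡0
    N∣n-2 : + N ∣ n - + 2
    N∣n-2 = ∣ᵤ⇒∣ n≡2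

  framed≡Id⇔ : framedMatrix a b n ≡ₘ Id [mod N ] ⇔ IdCondition
  framed≡Id⇔ = mk⇔ (congruent⇒IdCondition ∘ to (framed≡scalar⇔ (+ 1)))
                   (from (framed≡scalar⇔ (+ 1)) ∘ IdCondition⇒congruent)

  framed≡-Id⇔ : framedMatrix a b n ≡ₘ -Id [mod N ] ⇔ NegIdCondition
  framed≡-Id⇔ = mk⇔ (congruent⇒NegIdCondition ∘ to (framed≡scalar⇔ (- + 1)))
                    (from (framed≡scalar⇔ (- + 1)) ∘ NegIdCondition⇒congruent)

M-framed-solution⇔ : ∀ {N} a b k → let n = + k + + 2 in
  IsSolution N (a ∷ replicate k (+ 2) ++ b ∷ []) ⇔ (IdCondition {N} a b n ⊎ NegIdCondition a b n)
M-framed-solution⇔ {N} a b k =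
  subst (λ P → ((P ≡ₘ Id [mod N ]) ⊎ (P ≡ₘ -Id [mod N ])) ⇔ (IdCondition {N} a b n ⊎ NegIdCondition {N} a b n))
        (sym (M-framed a b k))
        (framed≡Id⇔ a b n ⊎-⇔ framed≡-Id⇔ a b n)
  where
  n : ℤ
  n = + k + + 2

mainTheorem20 : (N n : ℕ) → N ≥ 2 → n ≥ 3 → (a b : ℤ) →
    IsSolution N (a ∷ (replicate (n ∸ 2) (+ 2) ++ (b ∷ []))) ⇔
      ((a ≡ + 2 [mod N ]) × (b ≡ + 2 [mod N ]) × ((+ n) ≡ + 0 [mod N ])
        ⊎ (a ≡ + 0 [mod N ]) × (b ≡ + 0 [mod N ]) × ((+ n) ≡ + 2 [mod N ]))
mainTheorem20 N n _ n≥3 a b =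
  subst (λ m → IsSolution N tuple ⇔ (IdCondition {N} a b m ⊎ NegIdCondition {N} a b m))
        (cong +_ (m∸n+n≡m (<⇒≤ n≥3)))
        (M-framed-solution⇔ a b (n ∸ 2))
  where
  tuple : List ℤ
  tuple = a ∷ (replicate (n ∸ 2) (+ 2) ++ (b ∷ []))
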